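{- Let $a_0,b_0,c_0,d_0$ be constants and define sequences recursively by \begin{align*} a_{n+1}&=\frac{a_{n}^2 -a_n c_n - a_n d_n}{a_n-c_n}, & b_{n+1}&=b_{n},\\ c_{n+1}&=\frac {a_nc_n-2a_nd_n-c_n^{2}}{a_n-c_n}, & d_{n+1}&=\frac {a_nd_n}{a_n-c_n}, \end{align*} and set $\hat a_k=a_k-c_k$. Let $n>0$ and suppose $\hat a_k\neq0$ and $a_k\neq0$ for all $k\le n$. Then \begin{align*} a_{n+1}(c_0 - 2a_0 + a_n) &= a_0(c_0+d_0 -a_0),\\ \hat{a}_{n+1} &=- a_{n+1}+ 2a_0 - c_0 . \end{align*} -}

module Defs where

open import Level using (Level; _⊔_) renaming (suc to lsuc)
open import Algebra.Bundles using (CommutativeRing)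
open import Data.Nat using (ℕ; zero; suc)
open import Relation.Nullary using (¬_)

record Field (c ℓ : Level) : Set (lsuc (c ⊔ ℓ)) where
  field
    commutativeRing : CommutativeRing c ℓ
  open CommutativeRing commutativeRing public
  infix 8 _⁻¹
  field
    _⁻¹        : Carrier → Carrier
    ⁻¹-cong    : ∀ {x y} → x ≈ y → x ⁻¹ ≈ y ⁻¹
    ⁻¹-inverse : ∀ x → ¬ (x ≈ 0#) → x * x ⁻¹ ≈ 1#
    0≉1        : ¬ (0# ≈ 1#)

module Sequences {c ℓ : Level} (F : Field c ℓ) (a₀ b₀ c₀ d₀ : Field.Carrier F) where
  open Field F

  record Quad : Set c where
    constructor quad
    field
      qa qb qc qd : Carrier
  open Quad public

  step : Quad → Quad
  step (quad a b cc d) =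
    quad ((a * a - a * cc - a * d) * (a - cc) ⁻¹)
         b
         ((a * cc - (1# + 1#) * a * d - cc * cc) * (a - cc) ⁻¹)
         ((a * d) * (a - cc) ⁻¹)

  seq : ℕ → Quad
  seq zero    = quad a₀ b₀ c₀ d₀
  seq (suc n) = step (seq n)

  a b cs d : ℕ → Carrier
  a n  = qa (seq n)
  b n  = qb (seq n)
  cs n = qc (seq n)
  d n  = qd (seq n)

  â : ℕ → Carrier
  â k = a k - cs k

{-# OPTIONS --safe #-}
module Submission where

-- Along the recursion, 2a_k - c_k and a_k (c_k + d_k - a_k) are invariant,
-- and c_{k+1} + d_{k+1} - a_{k+1} = -(a_k - c_k); each of these is a polynomial
-- identity once the common denominator a_k - c_k is cancelled. At k = n the
-- linear invariant rewrites c_0 - 2a_0 + a_n as -(a_n - c_n), so the first claim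
-- is a_{n+1} (c_{n+1} + d_{n+1} - a_{n+1}) = a_0 (c_0 + d_0 - a_0); at k = n + 1 it
-- gives the second claim directly.

open import Defs
open import Level using (Level)
open import Algebra.Bundles using (CommutativeRing; RawRing)
open import Algebra.Solver.Ring.AlmostCommutativeRing
  using (fromCommutativeRing; _-Raw-AlmostCommutative⟶_)
open import Data.Maybe using (Maybe; map)
open import Data.Nat as ℕ using (ℕ; zero; suc; _≤_; _<_; _∸_; s≤s⁻¹)
open import Data.Nat.Properties using (_≟_; +-suc; ≤-refl; <⇒≤; n<1+n; m<n⇒m<1+n)
open import Data.Product using (_×_; _,_)
open import Relation.Nullary using (¬_)
open import Relation.Binary.PropositionalEquality as ≡ using (_≡_)
open import Relation.Nullary.Decidable using (dec⇒maybe)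

-- Integers as normalised differences (p , n) of naturals, denoting p·1 - n·1
-- in any commutative ring: the coefficients of a ring solver that can cancel.
module IntegerCoefficients {c ℓ} (R : CommutativeRing c ℓ) where
  open CommutativeRing R
  open import Relation.Binary.Reasoning.Setoid setoid
  open import Algebra.Properties.Semiring.Mult.TCOptimised semiring
    using (×-homo-+; ×1-homo-*) renaming (_×_ to _·_)
  open import Algebra.Properties.AbelianGroup +-abelianGroup
    using (⁻¹-∙-comm; ⁻¹-anti-homo‿-; ε⁻¹≈ε)
  open import Algebra.Properties.CommutativeSemigroup +-commutativeSemigroup
    using (interchange)
  open import Algebra.Properties.Ring ring using ([y-z]x≈yx-zx; x[y-z]≈xy-xz)

  ι : ℕ → Carrier
  ι n = n · 1#

  ι-+ : ∀ m n → ι (m ℕ.+ n) ≈ ι m + ι n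
  ι-+ = ×-homo-+ 1#

  [w+x]-[y+z]≈[w-y]+[x-z] : ∀ w x y z → (w + x) - (y + z) ≈ (w - y) + (x - z)
  [w+x]-[y+z]≈[w-y]+[x-z] w x y z =
    trans (+-congˡ (sym (⁻¹-∙-comm y z))) (interchange w x (- y) (- z))

  [x+z]-[y+z]≈x-y : ∀ x y z → (x + z) - (y + z) ≈ x - y
  [x+z]-[y+z]≈x-y x y z = begin
    (x + z) - (y + z)  ≈⟨ [w+x]-[y+z]≈[w-y]+[x-z] x z y z ⟩
    (x - y) + (z - z)  ≈⟨ +-congˡ (-‿inverseʳ z) ⟩
    (x - y) + 0#       ≈⟨ +-identityʳ (x - y) ⟩
    x - y              ∎

  w+z≈y+x⇒w-x≈y-z : ∀ {w x y z} → w + z ≈ y + x → w - x ≈ y - z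
  w+z≈y+x⇒w-x≈y-z {w} {x} {y} {z} eq = begin
    w - x              ≈⟨ [x+z]-[y+z]≈x-y w x z ⟨
    (w + z) - (x + z)  ≈⟨ +-cong eq (-‿cong (+-comm x z)) ⟩
    (y + x) - (z + x)  ≈⟨ [x+z]-[y+z]≈x-y y z x ⟩
    y - z              ∎

  [w-y][x-z]≈[wx+yz]-[wz+yx] : ∀ w x y z → (w - y) * (x - z) ≈ (w * x + y * z) - (w * z + y * x)
  [w-y][x-z]≈[wx+yz]-[wz+yx] w x y z = begin
    (w - y) * (x - z)                      ≈⟨ x[y-z]≈xy-xz (w - y) x z ⟩
    (w - y) * x - (w - y) * z              ≈⟨ +-cong ([y-z]x≈yx-zx x w y) (-‿cong ([y-z]x≈yx-zx z w y)) ⟩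
    (w * x - y * x) - (w * z - y * z)      ≈⟨ +-congˡ (⁻¹-anti-homo‿- (w * z) (y * z)) ⟩
    (w * x - y * x) + (y * z - w * z)      ≈⟨ [w+x]-[y+z]≈[w-y]+[x-z] (w * x) (y * z) (y * x) (w * z) ⟨
    (w * x + y * z) - (y * x + w * z)      ≈⟨ +-congˡ (-‿cong (+-comm (y * x) (w * z))) ⟩
    (w * x + y * z) - (w * z + y * x)      ∎

  Diff : Set
  Diff = ℕ × ℕ

  _⊖_ : ℕ → ℕ → Diff
  p ⊖ n = (p ∸ n , n ∸ p)

  p∸n+n≡p+[n∸p] : ∀ p n → (p ∸ n) ℕ.+ n ≡ p ℕ.+ (n ∸ p)
  p∸n+n≡p+[n∸p] zero    zero    = ≡.refl
  p∸n+n≡p+[n∸p] zero    (suc n) = ≡.refl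
  p∸n+n≡p+[n∸p] (suc p) zero    = ≡.refl
  p∸n+n≡p+[n∸p] (suc p) (suc n) = ≡.trans (+-suc (p ∸ n) n) (≡.cong suc (p∸n+n≡p+[n∸p] p n))

  Coeff : RawRing _ _
  Coeff = record
    { Carrier = Diff
    ; _≈_     = _≡_
    ; _+_     = λ { (p , n) (p′ , n′) → (p ℕ.+ p′) ⊖ (n ℕ.+ n′) }
    ; _*_     = λ { (p , n) (p′ , n′) →
                      (p ℕ.* p′ ℕ.+ n ℕ.* n′) ⊖ (p ℕ.* n′ ℕ.+ n ℕ.* p′) }
    ; -_      = λ { (p , n) → (n , p) }
    ; 0#      = (0 , 0)
    ; 1#      = (1 , 0)
    }

  -- Non-negative constants denote p·1 on the nose, so that e.g. con (2 , 0)
  -- is definitionally 1# + 1#.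
  ⟦_⟧ : Diff → Carrier
  ⟦ p , zero  ⟧ = ι p
  ⟦ p , suc n ⟧ = ι p - ι (suc n)

  ⟦p,n⟧≈ιp-ιn : ∀ p n → ⟦ p , n ⟧ ≈ ι p - ι n
  ⟦p,n⟧≈ιp-ιn p zero    = sym (trans (+-congˡ ε⁻¹≈ε) (+-identityʳ (ι p)))
  ⟦p,n⟧≈ιp-ιn p (suc n) = refl

  ⟦⟧-cong : ∀ p n p′ n′ → p ℕ.+ n′ ≡ p′ ℕ.+ n → ⟦ p , n ⟧ ≈ ⟦ p′ , n′ ⟧
  ⟦⟧-cong p n p′ n′ eq = begin
    ⟦ p , n ⟧      ≈⟨ ⟦p,n⟧≈ιp-ιn p n ⟩
    ι p - ι n      ≈⟨ w+z≈y+x⇒w-x≈y-z (trans (sym (ι-+ p n′)) (trans (reflexive (≡.cong ι eq)) (ι-+ p′ n))) ⟩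
    ι p′ - ι n′    ≈⟨ ⟦p,n⟧≈ιp-ιn p′ n′ ⟨
    ⟦ p′ , n′ ⟧    ∎

  ⟦⊖⟧ : ∀ p n → ⟦ p ⊖ n ⟧ ≈ ι p - ι n
  ⟦⊖⟧ p n = trans (⟦⟧-cong (p ∸ n) (n ∸ p) p n (p∸n+n≡p+[n∸p] p n)) (⟦p,n⟧≈ιp-ιn p n)

  morphism : Coeff -Raw-AlmostCommutative⟶ fromCommutativeRing R
  morphism = record
    { ⟦_⟧    = ⟦_⟧
    ; +-homo = +-homo
    ; *-homo = *-homo
    ; -‿homo = -‿homo
    ; 0-homo = refl
    ; 1-homo = refl
    }
    where
    +-homo : ∀ x y → ⟦ RawRing._+_ Coeff x y ⟧ ≈ ⟦ x ⟧ + ⟦ y ⟧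
    +-homo (p , n) (p′ , n′) = begin
      ⟦ (p ℕ.+ p′) ⊖ (n ℕ.+ n′) ⟧         ≈⟨ ⟦⊖⟧ (p ℕ.+ p′) (n ℕ.+ n′) ⟩
      ι (p ℕ.+ p′) - ι (n ℕ.+ n′)         ≈⟨ +-cong (ι-+ p p′) (-‿cong (ι-+ n n′)) ⟩
      (ι p + ι p′) - (ι n + ι n′)         ≈⟨ [w+x]-[y+z]≈[w-y]+[x-z] (ι p) (ι p′) (ι n) (ι n′) ⟩
      (ι p - ι n) + (ι p′ - ι n′)         ≈⟨ +-cong (⟦p,n⟧≈ιp-ιn p n) (⟦p,n⟧≈ιp-ιn p′ n′) ⟨
      ⟦ p , n ⟧ + ⟦ p′ , n′ ⟧             ∎

    ι-*+* : ∀ p q r s → ι (p ℕ.* q ℕ.+ r ℕ.* s) ≈ ι p * ι q + ι r * ι s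
    ι-*+* p q r s = trans (ι-+ (p ℕ.* q) (r ℕ.* s)) (+-cong (×1-homo-* p q) (×1-homo-* r s))

    *-homo : ∀ x y → ⟦ RawRing._*_ Coeff x y ⟧ ≈ ⟦ x ⟧ * ⟦ y ⟧
    *-homo (p , n) (p′ , n′) = begin
      ⟦ (p ℕ.* p′ ℕ.+ n ℕ.* n′) ⊖ (p ℕ.* n′ ℕ.+ n ℕ.* p′) ⟧
        ≈⟨ ⟦⊖⟧ (p ℕ.* p′ ℕ.+ n ℕ.* n′) (p ℕ.* n′ ℕ.+ n ℕ.* p′) ⟩
      ι (p ℕ.* p′ ℕ.+ n ℕ.* n′) - ι (p ℕ.* n′ ℕ.+ n ℕ.* p′)
        ≈⟨ +-cong (ι-*+* p p′ n n′) (-‿cong (ι-*+* p n′ n p′)) ⟩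
      (ι p * ι p′ + ι n * ι n′) - (ι p * ι n′ + ι n * ι p′)
        ≈⟨ [w-y][x-z]≈[wx+yz]-[wz+yx] (ι p) (ι p′) (ι n) (ι n′) ⟨
      (ι p - ι n) * (ι p′ - ι n′)
        ≈⟨ *-cong (⟦p,n⟧≈ιp-ιn p n) (⟦p,n⟧≈ιp-ιn p′ n′) ⟨
      ⟦ p , n ⟧ * ⟦ p′ , n′ ⟧
        ∎

    -‿homo : ∀ x → ⟦ RawRing.-_ Coeff x ⟧ ≈ - ⟦ x ⟧
    -‿homo (p , n) = begin
      ⟦ n , p ⟧      ≈⟨ ⟦p,n⟧≈ιp-ιn n p ⟩
      ι n - ι p      ≈⟨ ⁻¹-anti-homo‿- (ι p) (ι n) ⟨
      - (ι p - ι n)  ≈⟨ -‿cong (⟦p,n⟧≈ιp-ιn p n) ⟨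
      - ⟦ p , n ⟧    ∎

  ⟦⟧-≈? : ∀ x y → Maybe (⟦ x ⟧ ≈ ⟦ y ⟧)
  ⟦⟧-≈? (p , n) (p′ , n′) = map (⟦⟧-cong p n p′ n′) (dec⇒maybe (p ℕ.+ n′ ≟ p′ ℕ.+ n))

module IntegerCoefficientSolver {c ℓ} (R : CommutativeRing c ℓ) where
  open IntegerCoefficients R using (Coeff; morphism; ⟦⟧-≈?)
  open import Algebra.Solver.Ring Coeff (fromCommutativeRing R) morphism ⟦⟧-≈? public

module DoubledDifference {c ℓ} (R : CommutativeRing c ℓ) where
  open CommutativeRing R
  open IntegerCoefficientSolver R
  open import Relation.Binary.Reasoning.Setoid setoid

  x+x-y≈p+p-q⇒q-[p+p]+x≈-[x-y] : ∀ {x y p q} → x + x - y ≈ p + p - q → q - (p + p) + x ≈ - (x - y)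
  x+x-y≈p+p-q⇒q-[p+p]+x≈-[x-y] {x} {y} {p} {q} eq = begin
    q - (p + p) + x      ≈⟨ solve 3 (λ p q x → q :- (p :+ p) :+ x := :- (p :+ p :- q) :+ x) refl p q x ⟩
    - (p + p - q) + x    ≈⟨ +-congʳ (-‿cong eq) ⟨
    - (x + x - y) + x    ≈⟨ solve 2 (λ x y → :- (x :+ x :- y) :+ x := :- (x :- y)) refl x y ⟩
    - (x - y)            ∎

  x+x-y≈p+p-q⇒x-y≈-x+[p+p]-q : ∀ {x y p q} → x + x - y ≈ p + p - q → x - y ≈ - x + (p + p) - q
  x+x-y≈p+p-q⇒x-y≈-x+[p+p]-q {x} {y} {p} {q} eq = begin
    x - y                ≈⟨ solve 2 (λ x y → x :- y := :- x :+ (x :+ x :- y)) refl x y ⟩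
    - x + (x + x - y)    ≈⟨ +-congˡ eq ⟩
    - x + (p + p - q)    ≈⟨ +-assoc (- x) (p + p) (- q) ⟨
    - x + (p + p) - q    ∎

module Invariants {c ℓ} (F : Field c ℓ) (a₀ b₀ c₀ d₀ : Field.Carrier F) where
  open Field F
  open Sequences F a₀ b₀ c₀ d₀
  open IntegerCoefficientSolver commutativeRing

  *-inverse-cancelʳ : ∀ {v} → ¬ (v ≈ 0#) → ∀ w → w * (v * v ⁻¹) ≈ w
  *-inverse-cancelʳ v≉0 w = trans (*-congˡ (⁻¹-inverse _ v≉0)) (*-identityʳ w)

  -- In each lemma the numerator equals (right-hand side) · (a - c), which the
  -- inverse cancels.
  step-2a-c : ∀ q → ¬ (qa q - qc q ≈ 0#) →
              qa (step q) + qa (step q) - qc (step q) ≈ qa q + qa q - qc q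
  step-2a-c (quad x _ y z) x-y≉0 = trans
    (solve 4 (λ x y z w →
        (x :* x :- x :* y :- x :* z) :* w :+ (x :* x :- x :* y :- x :* z) :* w
          :- (x :* y :- con (2 , 0) :* x :* z :- y :* y) :* w
        := (x :+ x :- y) :* ((x :- y) :* w))
      refl x y z ((x - y) ⁻¹))
    (*-inverse-cancelʳ x-y≉0 _)

  step-c+d-a : ∀ q → ¬ (qa q - qc q ≈ 0#) →
               qc (step q) + qd (step q) - qa (step q) ≈ - (qa q - qc q)
  step-c+d-a (quad x _ y z) x-y≉0 = trans
    (solve 4 (λ x y z w →
        (x :* y :- con (2 , 0) :* x :* z :- y :* y) :* w :+ (x :* z) :* w
          :- (x :* x :- x :* y :- x :* z) :* w
        := (:- (x :- y)) :* ((x :- y) :* w))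
      refl x y z ((x - y) ⁻¹))
    (*-inverse-cancelʳ x-y≉0 _)

  step-a*-[a-c] : ∀ q → ¬ (qa q - qc q ≈ 0#) →
                  qa (step q) * - (qa q - qc q) ≈ qa q * (qc q + qd q - qa q)
  step-a*-[a-c] (quad x _ y z) x-y≉0 = trans
    (solve 4 (λ x y z w →
        ((x :* x :- x :* y :- x :* z) :* w) :* (:- (x :- y))
        := (x :* (y :+ z :- x)) :* ((x :- y) :* w))
      refl x y z ((x - y) ⁻¹))
    (*-inverse-cancelʳ x-y≉0 _)

  step-a*[c+d-a] : ∀ q → ¬ (qa q - qc q ≈ 0#) →
                   qa (step q) * (qc (step q) + qd (step q) - qa (step q)) ≈ qa q * (qc q + qd q - qa q)
  step-a*[c+d-a] q â≉0 = trans (*-congˡ (step-c+d-a q â≉0)) (step-a*-[a-c] q â≉0)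

  seq-invariant : (P : Quad → Carrier) → (∀ q → ¬ (qa q - qc q ≈ 0#) → P (step q) ≈ P q) →
                  ∀ m → (∀ k → k < m → ¬ (â k ≈ 0#)) → P (seq m) ≈ P (seq 0)
  seq-invariant P step-P zero    _   = refl
  seq-invariant P step-P (suc m) â≉0 = trans
    (step-P (seq m) (â≉0 m (n<1+n m)))
    (seq-invariant P step-P m (λ k k<m → â≉0 k (m<n⇒m<1+n k<m)))

  2a-c-invariant : ∀ m → (∀ k → k < m → ¬ (â k ≈ 0#)) → a m + a m - cs m ≈ a₀ + a₀ - c₀
  2a-c-invariant = seq-invariant (λ q → qa q + qa q - qc q) step-2a-c

  a*[c+d-a]-invariant : ∀ m → (∀ k → k < m → ¬ (â k ≈ 0#)) →
                        a m * (cs m + d m - a m) ≈ a₀ * (c₀ + d₀ - a₀)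
  a*[c+d-a]-invariant = seq-invariant (λ q → qa q * (qc q + qd q - qa q)) step-a*[c+d-a]

theorem6 : ∀ {c ℓ : Level} (F : Field c ℓ) (a₀ b₀ c₀ d₀ : Field.Carrier F) (n : ℕ) →
    let open Field F
        open Sequences F a₀ b₀ c₀ d₀
    in 0 < n →
       (∀ k → k ≤ n → ¬ (â k ≈ 0#)) →
       (∀ k → k ≤ n → ¬ (a k ≈ 0#)) →
       (a (suc n) * (c₀ - (a₀ + a₀) + a n) ≈ a₀ * (c₀ + d₀ - a₀))
       × (â (suc n) ≈ - a (suc n) + (a₀ + a₀) - c₀)
theorem6 F a₀ b₀ c₀ d₀ n _ â≉0 _ = first , second
  where
  open Field F
  open Sequences F a₀ b₀ c₀ d₀
  open Invariants F a₀ b₀ c₀ d₀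
  open DoubledDifference commutativeRing
  open import Relation.Binary.Reasoning.Setoid setoid

  â≉0-below-n : ∀ k → k < n → ¬ (â k ≈ 0#)
  â≉0-below-n k k<n = â≉0 k (<⇒≤ k<n)

  â≉0-below-1+n : ∀ k → k < suc n → ¬ (â k ≈ 0#)
  â≉0-below-1+n k k<1+n = â≉0 k (s≤s⁻¹ k<1+n)

  first : a (suc n) * (c₀ - (a₀ + a₀) + a n) ≈ a₀ * (c₀ + d₀ - a₀)
  first = begin
    a (suc n) * (c₀ - (a₀ + a₀) + a n)
      ≈⟨ *-congˡ (x+x-y≈p+p-q⇒q-[p+p]+x≈-[x-y] (2a-c-invariant n â≉0-below-n)) ⟩
    a (suc n) * - â n
      ≈⟨ step-a*-[a-c] (seq n) (â≉0 n ≤-refl) ⟩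
    a n * (cs n + d n - a n)
      ≈⟨ a*[c+d-a]-invariant n â≉0-below-n ⟩
    a₀ * (c₀ + d₀ - a₀)
      ∎

  second : â (suc n) ≈ - a (suc n) + (a₀ + a₀) - c₀
  second = x+x-y≈p+p-q⇒x-y≈-x+[p+p]-q (2a-c-invariant (suc n) â≉0-below-1+n)
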